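{- Let $k\ge 1$ and $h\ge 1$ be integers and let $T$ be the complete $k$-ary tree of height $h$. Then $md(T)$ is finite if and only if $k=1$ or $k=2$. Moreover, if $T$ is the complete binary tree of height $h$, then $md(T)=2^h-1$.
   Context: The complete $k$-ary tree of height $h$ is the rooted tree in which every vertex at levels $0,\dots,h-1$ has exactly $k$ children and all leaves are at level $h$. For $W\subseteq V(T)$, $r_m(v|W)$ is the multiset $\{d(v,w): w\in W\}$ of graph distances; $W$ is an m-resolving set if $r_m(u|W)\neq r_m(v|W)$ for all distinct $u,v$. If $T$ has an m-resolving set, $md(T)$ is the minimum cardinality of one; otherwise $md(T)=\infty$. -}

module Defs where

open import Data.Nat using (ℕ; zero; suc; _+_; _*_; _∸_; _≤_)
open import Data.Fin using (Fin)
open import Data.Fin.Properties using () renaming (_≟_ to _≟ᶠ_)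
open import Data.List using (List; []; _∷_; length; map)
open import Data.Product using (Σ; ∃; _×_; _,_; proj₁)
open import Data.List.Relation.Unary.Unique.Propositional using (Unique)
open import Data.List.Relation.Binary.Permutation.Propositional using (_↭_)
open import Relation.Binary.PropositionalEquality using (_≡_)
open import Relation.Nullary using (yes; no)

-- Vertices of the complete k-ary tree of height h: a vertex is identified
-- with the path of child-indices from the root (the root is []); its level
-- is the length of the path, which is at most h.  Two vertices are adjacent
-- iff one path is the other extended by one index.
Vertex : ℕ → ℕ → Set
Vertex k h = Σ (List (Fin k)) (λ p → length p ≤ h)

lcp : ∀ {k} → List (Fin k) → List (Fin k) → ℕ
lcp [] _ = zero
lcp (_ ∷ _) [] = zero
lcp (x ∷ xs) (y ∷ ys) with x ≟ᶠ y
... | yes _ = suc (lcp xs ys)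
... | no _ = zero

-- graph distance in the tree: the unique path from u to v goes through
-- their lowest common ancestor, so d(u,v) = |u| + |v| - 2 |lca(u,v)|
dist : ∀ {k h} → Vertex k h → Vertex k h → ℕ
dist (u , _) (v , _) = (length u + length v) ∸ 2 * lcp u v

-- r_m(v|W) : the multiset of distances from v to the vertices of W,
-- represented as a list (multiset equality = permutation _↭_)
rm : ∀ {k h} → Vertex k h → List (Vertex k h) → List ℕ
rm v W = map (dist v) W

IsMResolving : ∀ {k h} → List (Vertex k h) → Set
IsMResolving {k} {h} W = (u v : Vertex k h) → rm u W ↭ rm v W → u ≡ v

MdFinite : ℕ → ℕ → Set
MdFinite k h = ∃ λ (W : List (Vertex k h)) → Unique W × IsMResolving W

MdEq : ℕ → ℕ → ℕ → Set
MdEq k h m =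
  (∃ λ (W : List (Vertex k h)) → Unique W × IsMResolving W × length W ≡ m)
  × ((W : List (Vertex k h)) → Unique W → IsMResolving W → m ≤ length W)

{-# OPTIONS --safe #-}
-- Distance multisets are compared through the sums Σ_{w ∈ W} g (d(u, w)) over all g : ℕ → ℕ.
-- Moving from a vertex to its child c shifts the distances to W by +1 outside the subtree of c
-- and by −1 inside it, so two siblings whose subtrees contain equally many vertices of W at each
-- depth have the same distance multiset. Sibling leaves are thus separated only by membership in
-- W, and for k ≥ 3 two of them agree (pigeonhole). For k = 2, induction from the leaves shows that
-- W contains exactly one child of every internal vertex, so |W| ≥ 2^h − 1. The set of all left
-- children attains this bound: the largest distance from u to it determines the level of u, and
-- the number of left children within distance (level + 1) reads off the first step of the path
-- to u, recursively. For k = 1 the root alone resolves the path.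
module Submission where

open import Defs
open import Level using (Level)
open import Algebra.Properties.CommutativeSemigroup using (interchange)
open import Data.Empty using (⊥-elim)
open import Data.Fin using (Fin; fromℕ<)
open import Data.Fin.Patterns using (0F; 1F)
open import Data.Fin.Properties using (pigeonhole; fromℕ<-injective)
  renaming (_≟_ to _≟ᶠ_; <⇒≢ to <⇒≢ᶠ)
open import Data.List using (List; []; _∷_; [_]; _++_; _∷ʳ_; length; map; replicate)
open import Data.List.Membership.Propositional using (_∈_)
open import Data.List.Membership.Propositional.Properties using (∈-∃++; ∈-map⁻)
open import Data.List.Properties
  using (≡-dec; map-++; map-∘; map-cong; length-++; length-replicate; ∷-injectiveˡ; ∷-injectiveʳ; ∷ʳ-injectiveʳ)
open import Data.List.Relation.Binary.Disjoint.Propositional using (Disjoint)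
open import Data.List.Relation.Binary.Permutation.Propositional using (_↭_; ↭-refl; ↭-sym; ↭-trans; prep)
open import Data.List.Relation.Binary.Permutation.Propositional.Properties using (map⁺; shift; ↭-singleton-inv)
open import Data.List.Relation.Unary.All as All using (All; []; _∷_)
import Data.List.Relation.Unary.All.Properties as Allₚ
open import Data.List.Relation.Unary.Any using (here; there)
open import Data.List.Relation.Unary.Unique.Propositional using (Unique; []; _∷_)
import Data.List.Relation.Unary.Unique.Propositional.Properties as Uniqueₚ
open import Data.Nat using (ℕ; zero; suc; _+_; _*_; _∸_; _^_; _≤_; _<_; z≤n; s≤s; _≤?_)
open import Data.Nat.ListAction using (sum)
open import Data.Nat.ListAction.Properties using (sum-++; sum-↭)
open import Data.Nat.Properties
open import Data.Nat.Tactic.RingSolver using (solve-∀)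
open import Data.Product using (_×_; _,_; proj₁; proj₂)
open import Data.Sum using (_⊎_; inj₁; inj₂)
open import Function using (_∘_; id)
open import Function.Bundles using (_⇔_; mk⇔)
open import Relation.Binary.Definitions using (DecidableEquality; tri<; tri≈; tri>)
open import Relation.Binary.PropositionalEquality
  using (_≡_; _≢_; refl; sym; trans; cong; cong₂; subst; module ≡-Reasoning)
open import Relation.Nullary using (Dec; yes; no; ¬_; contradiction)

private
  variable
    a : Level
    A : Set a
    k h : ℕ

∑ : List A → (A → ℕ) → ℕ
∑ xs f = sum (map f xs)

𝟙[_] : ∀ {p} {P : Set p} → Dec P → ℕ
𝟙[ yes _ ] = 1
𝟙[ no _ ] = 0

𝟙-yes : ∀ {p} {P : Set p} (d : Dec P) → P → 𝟙[ d ] ≡ 1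
𝟙-yes (yes _) _ = refl
𝟙-yes (no ¬p) p = contradiction p ¬p

𝟙-no : ∀ {p} {P : Set p} (d : Dec P) → ¬ P → 𝟙[ d ] ≡ 0
𝟙-no (yes p) ¬p = contradiction p ¬p
𝟙-no (no _) _ = refl

𝟙-cong : ∀ {p q} {P : Set p} {Q : Set q} (d : Dec P) (e : Dec Q) → (P → Q) → (Q → P) → 𝟙[ d ] ≡ 𝟙[ e ]
𝟙-cong (yes _) (yes _) _ _ = refl
𝟙-cong (no _) (no _) _ _ = refl
𝟙-cong (yes p) (no ¬q) P→Q _ = contradiction (P→Q p) ¬q
𝟙-cong (no ¬p) (yes q) _ Q→P = contradiction (Q→P q) ¬p

∑-++ : ∀ xs ys (f : A → ℕ) → ∑ (xs ++ ys) f ≡ ∑ xs f + ∑ ys f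
∑-++ xs ys f = trans (cong sum (map-++ f xs ys)) (sum-++ (map f xs) (map f ys))

∑-map : ∀ {b} {B : Set b} (g : A → B) xs (f : B → ℕ) → ∑ (map g xs) f ≡ ∑ xs (f ∘ g)
∑-map g xs f = cong sum (sym (map-∘ xs))

∑-cong : ∀ {f g : A → ℕ} xs → (∀ x → f x ≡ g x) → ∑ xs f ≡ ∑ xs g
∑-cong xs f≗g = cong sum (map-cong f≗g xs)

∑-+ : ∀ xs (f g : A → ℕ) → ∑ xs (λ x → f x + g x) ≡ ∑ xs f + ∑ xs g
∑-+ [] f g = refl
∑-+ (x ∷ xs) f g =
  trans (cong (f x + g x +_) (∑-+ xs f g)) (interchange +-commutativeSemigroup (f x) (g x) (∑ xs f) (∑ xs g))

∑-*ʳ : ∀ xs (f : A → ℕ) c → ∑ xs (λ x → f x * c) ≡ ∑ xs f * c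
∑-*ʳ [] f c = refl
∑-*ʳ (x ∷ xs) f c = trans (cong (f x * c +_) (∑-*ʳ xs f c)) (sym (*-distribʳ-+ c (f x) (∑ xs f)))

∑-zero : ∀ {f : A → ℕ} {xs} → All (λ x → f x ≡ 0) xs → ∑ xs f ≡ 0
∑-zero [] = refl
∑-zero (fx≡0 ∷ fxs≡0) = cong₂ _+_ fx≡0 (∑-zero fxs≡0)

∑-1≡length : ∀ (xs : List A) → ∑ xs (λ _ → 1) ≡ length xs
∑-1≡length [] = refl
∑-1≡length (_ ∷ xs) = cong suc (∑-1≡length xs)

∑-↭ : ∀ {xs ys} (f : A → ℕ) → xs ↭ ys → ∑ xs f ≡ ∑ ys f
∑-↭ f xs↭ys = sum-↭ (map⁺ f xs↭ys)

module _ (_≟_ : DecidableEquality A) where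

  count-pos⇒∈ : ∀ x ys → 1 ≤ ∑ ys (λ y → 𝟙[ y ≟ x ]) → x ∈ ys
  count-pos⇒∈ x [] ()
  count-pos⇒∈ x (y ∷ ys) 1≤count with y ≟ x
  ... | yes refl = here refl
  ... | no _ = there (count-pos⇒∈ x ys 1≤count)

  sums⇒∈ : ∀ x xs ys → (∀ f → ∑ (x ∷ xs) f ≡ ∑ ys f) → x ∈ ys
  sums⇒∈ x xs ys same = count-pos⇒∈ x ys
    (subst (1 ≤_) (same _) (≤-trans (≤-reflexive (sym (𝟙-yes (x ≟ x) refl))) (m≤m+n _ _)))

  sums⇒↭ : ∀ xs ys → (∀ f → ∑ xs f ≡ ∑ ys f) → xs ↭ ys
  sums⇒↭ [] [] _ = ↭-refl
  sums⇒↭ [] (_ ∷ _) same with () ← same (λ _ → 1)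
  sums⇒↭ (x ∷ xs) ys same with ys₁ , ys₂ , refl ← ∈-∃++ (sums⇒∈ x xs ys same) =
    ↭-trans (prep x (sums⇒↭ xs (ys₁ ++ ys₂) same-rest)) (↭-sym (shift x ys₁ ys₂))
    where
    same-rest : ∀ f → ∑ xs f ≡ ∑ (ys₁ ++ ys₂) f
    same-rest f = +-cancelˡ-≡ (f x) _ _ (trans (same f) (∑-↭ f (shift x ys₁ ys₂)))

pathDist : List (Fin k) → List (Fin k) → ℕ
pathDist u w = (length u + length w) ∸ 2 * lcp u w

lcp-∷ : ∀ (x : Fin k) u w → lcp (x ∷ u) (x ∷ w) ≡ suc (lcp u w)
lcp-∷ x u w with x ≟ᶠ x
... | yes _ = refl
... | no x≢x = contradiction refl x≢x

lcp-∷-≢ : ∀ {x y : Fin k} → x ≢ y → ∀ u w → lcp (x ∷ u) (y ∷ w) ≡ 0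
lcp-∷-≢ {x = x} {y} x≢y u w with x ≟ᶠ y
... | yes x≡y = contradiction x≡y x≢y
... | no _ = refl

pathDist-∷ : ∀ (x : Fin k) u w → pathDist (x ∷ u) (x ∷ w) ≡ pathDist u w
pathDist-∷ x u w =
  cong₂ _∸_ (cong suc (+-suc (length u) (length w))) (trans (cong (2 *_) (lcp-∷ x u w)) (*-suc 2 (lcp u w)))

pathDist-∷-≢ : ∀ {x y : Fin k} → x ≢ y → ∀ u w →
  pathDist (x ∷ u) (y ∷ w) ≡ suc (length u) + suc (length w)
pathDist-∷-≢ x≢y u w = cong (λ l → (suc (length u) + suc (length w)) ∸ 2 * l) (lcp-∷-≢ x≢y u w)

pathDist-[]ʳ : ∀ (u : List (Fin k)) → pathDist u [] ≡ length u
pathDist-[]ʳ [] = refl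
pathDist-[]ʳ (_ ∷ u) = +-identityʳ (suc (length u))

pathDist≤ : ∀ (u w : List (Fin k)) → pathDist u w ≤ length u + length w
pathDist≤ u w = m∸n≤m (length u + length w) (2 * lcp u w)

vertex-≡ : ∀ {u v : Vertex k h} → proj₁ u ≡ proj₁ v → u ≡ v
vertex-≡ {u = p , _} {.p , _} refl = cong (p ,_) (≤-irrelevant _ _)

length-∷ʳ : ∀ (p : List A) x → length (p ∷ʳ x) ≡ suc (length p)
length-∷ʳ p x = trans (length-++ p) (+-comm (length p) 1)

distSum : List (Vertex k h) → List (Fin k) → (ℕ → ℕ) → ℕ
distSum W u g = ∑ W (λ w → g (pathDist u (proj₁ w)))

module _ (W : List (Vertex k h)) (u v : Vertex k h) where

  rm-↭⇒distSum-≡ : rm u W ↭ rm v W → ∀ g → distSum W (proj₁ u) g ≡ distSum W (proj₁ v) g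
  rm-↭⇒distSum-≡ u↭v g = trans (sym (∑-map (dist u) W g)) (trans (∑-↭ g u↭v) (∑-map (dist v) W g))

  distSum-≡⇒rm-↭ : (∀ g → distSum W (proj₁ u) g ≡ distSum W (proj₁ v) g) → rm u W ↭ rm v W
  distSum-≡⇒rm-↭ same = sums⇒↭ _≟_ (rm u W) (rm v W) λ g →
    trans (∑-map (dist u) W g) (trans (same g) (sym (∑-map (dist v) W g)))

-- weightBelow r w φ is φ (depth of w below r) if w lies in the subtree of r, and 0 otherwise;
-- so profile W r records how many vertices of W the subtree of r contains at each depth.
weightBelow : List (Fin k) → List (Fin k) → (ℕ → ℕ) → ℕ
weightBelow [] w φ = φ (length w)
weightBelow (_ ∷ _) [] φ = 0
weightBelow (x ∷ r) (y ∷ w) φ with x ≟ᶠ y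
... | yes _ = weightBelow r w φ
... | no _ = 0

profile : List (Vertex k h) → List (Fin k) → (ℕ → ℕ) → ℕ
profile W r φ = ∑ W (λ w → weightBelow r (proj₁ w) φ)

_≟ₚ_ : DecidableEquality (List (Fin k))
_≟ₚ_ = ≡-dec _≟ᶠ_

multiplicity : List (Vertex k h) → List (Fin k) → ℕ
multiplicity W r = ∑ W (λ w → 𝟙[ r ≟ₚ proj₁ w ])

weightBelow-∷ : ∀ (x : Fin k) r w φ → weightBelow (x ∷ r) (x ∷ w) φ ≡ weightBelow r w φ
weightBelow-∷ x r w φ with x ≟ᶠ x
... | yes _ = refl
... | no x≢x = contradiction refl x≢x

weightBelow-∷-≢ : ∀ {x y : Fin k} → x ≢ y → ∀ r w φ → weightBelow (x ∷ r) (y ∷ w) φ ≡ 0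
weightBelow-∷-≢ {x = x} {y} x≢y r w φ with x ≟ᶠ y
... | yes x≡y = contradiction x≡y x≢y
... | no _ = refl

𝟙-∷ : ∀ (x : Fin k) r w → 𝟙[ (x ∷ r) ≟ₚ (x ∷ w) ] ≡ 𝟙[ r ≟ₚ w ]
𝟙-∷ x r w = 𝟙-cong (_ ≟ₚ _) (r ≟ₚ w) ∷-injectiveʳ (cong (x ∷_))

𝟙-∷-≢ : ∀ {x y : Fin k} → x ≢ y → ∀ r w → 𝟙[ (x ∷ r) ≟ₚ (y ∷ w) ] ≡ 0
𝟙-∷-≢ x≢y r w = 𝟙-no (_ ≟ₚ _) (x≢y ∘ ∷-injectiveˡ)

weightBelow-leaf : ∀ (r w : List (Fin k)) φ → length w ≤ length r → weightBelow r w φ ≡ 𝟙[ r ≟ₚ w ] * φ 0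
weightBelow-leaf [] [] φ _ = sym (*-identityˡ (φ 0))
weightBelow-leaf (x ∷ r) [] φ _ = refl
weightBelow-leaf (x ∷ r) (y ∷ w) φ (s≤s w≤r) = by-heads (x ≟ᶠ y)
  where
  by-heads : Dec (x ≡ y) → weightBelow (x ∷ r) (y ∷ w) φ ≡ 𝟙[ (x ∷ r) ≟ₚ (y ∷ w) ] * φ 0
  by-heads (yes refl) =
    trans (weightBelow-∷ x r w φ) (trans (weightBelow-leaf r w φ w≤r) (cong (_* φ 0) (sym (𝟙-∷ x r w))))
  by-heads (no x≢y) = trans (weightBelow-∷-≢ x≢y r w φ) (cong (_* φ 0) (sym (𝟙-∷-≢ x≢y r w)))

weightBelow-beyond : ∀ (r w : List (Fin k)) φ → length w < length r → weightBelow r w φ ≡ 0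
weightBelow-beyond r w φ w<r = trans (weightBelow-leaf r w φ (<⇒≤ w<r))
  (cong (_* φ 0) (𝟙-no (r ≟ₚ w) (λ r≡w → <⇒≢ w<r (cong length (sym r≡w)))))

profile-leaf : ∀ (W : List (Vertex k h)) r φ → length r ≡ h → profile W r φ ≡ multiplicity W r * φ 0
profile-leaf W r φ r≡h = trans
  (∑-cong W (λ w → weightBelow-leaf r (proj₁ w) φ (subst (_ ≤_) (sym r≡h) (proj₂ w))))
  (∑-*ʳ W (λ w → 𝟙[ r ≟ₚ proj₁ w ]) (φ 0))

profile-beyond : ∀ (W : List (Vertex k h)) r φ → h < length r → profile W r φ ≡ 0
profile-beyond W r φ h<r =
  ∑-zero (All.universal (λ w → weightBelow-beyond r (proj₁ w) φ (≤-<-trans (proj₂ w) h<r)) W)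

multiplicity≤1 : ∀ {W : List (Vertex k h)} → Unique W → ∀ r → multiplicity W r ≤ 1
multiplicity≤1 [] r = z≤n
multiplicity≤1 {W = w ∷ W} (w∉W ∷ W-unique) r with r ≟ₚ proj₁ w
... | no _ = multiplicity≤1 W-unique r
... | yes refl = ≤-reflexive (cong suc
      (∑-zero (All.map (λ w≢v → 𝟙-no (_ ≟ₚ _) (w≢v ∘ vertex-≡)) w∉W)))

-- Moving from p down to its child p ∷ʳ x adds 1 to the distance of every vertex outside the
-- subtree of the child and subtracts 1 inside it (stated with both sides moved, to avoid ∸).
pathDist-child : ∀ (p : List (Fin k)) x w (g : ℕ → ℕ) →
  g (pathDist (p ∷ʳ x) w) + weightBelow (p ∷ʳ x) w (g ∘ (2 +_))
    ≡ g (suc (pathDist p w)) + weightBelow (p ∷ʳ x) w g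
pathDist-child [] x [] g = refl
pathDist-child [] x (y ∷ w) g with x ≟ᶠ y
... | yes refl = +-comm (g (length w)) _
... | no _ = refl
pathDist-child (z ∷ p) x [] g =
  cong (λ n → g n + 0) (trans (pathDist-[]ʳ (z ∷ p ∷ʳ x))
    (cong suc (trans (length-∷ʳ p x) (sym (pathDist-[]ʳ (z ∷ p))))))
pathDist-child (z ∷ p) x (y ∷ w) g = by-heads (z ≟ᶠ y)
  where
  by-heads : Dec (z ≡ y) →
    g (pathDist (z ∷ p ∷ʳ x) (y ∷ w)) + weightBelow (z ∷ p ∷ʳ x) (y ∷ w) (g ∘ (2 +_))
      ≡ g (suc (pathDist (z ∷ p) (y ∷ w))) + weightBelow (z ∷ p ∷ʳ x) (y ∷ w) g
  by-heads (yes refl)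
    rewrite pathDist-∷ z (p ∷ʳ x) w | pathDist-∷ z p w
          | weightBelow-∷ z (p ∷ʳ x) w (g ∘ (2 +_)) | weightBelow-∷ z (p ∷ʳ x) w g
    = pathDist-child p x w g
  by-heads (no z≢y)
    rewrite pathDist-∷-≢ z≢y (p ∷ʳ x) w | pathDist-∷-≢ z≢y p w
          | weightBelow-∷-≢ z≢y (p ∷ʳ x) w (g ∘ (2 +_)) | weightBelow-∷-≢ z≢y (p ∷ʳ x) w g
          | length-∷ʳ p x
    = refl

distSum-child : ∀ (W : List (Vertex k h)) p x g →
  distSum W (p ∷ʳ x) g + profile W (p ∷ʳ x) (g ∘ (2 +_)) ≡ distSum W p (g ∘ suc) + profile W (p ∷ʳ x) g
distSum-child W p x g = begin
  distSum W (p ∷ʳ x) g + profile W (p ∷ʳ x) (g ∘ (2 +_))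
    ≡⟨ ∑-+ W _ _ ⟨
  ∑ W (λ w → g (pathDist (p ∷ʳ x) (proj₁ w)) + weightBelow (p ∷ʳ x) (proj₁ w) (g ∘ (2 +_)))
    ≡⟨ ∑-cong W (λ w → pathDist-child p x (proj₁ w) g) ⟩
  ∑ W (λ w → g (suc (pathDist p (proj₁ w))) + weightBelow (p ∷ʳ x) (proj₁ w) g)
    ≡⟨ ∑-+ W _ _ ⟩
  distSum W p (g ∘ suc) + profile W (p ∷ʳ x) g ∎
  where open ≡-Reasoning

siblings-distSum-≡ : ∀ (W : List (Vertex k h)) p x y →
  (∀ φ → profile W (p ∷ʳ x) φ ≡ profile W (p ∷ʳ y) φ) → ∀ g → distSum W (p ∷ʳ x) g ≡ distSum W (p ∷ʳ y) g
siblings-distSum-≡ W p x y same-profile g = +-cancelʳ-≡ (profile W (p ∷ʳ x) (g ∘ (2 +_))) _ _ (begin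
  distSum W (p ∷ʳ x) g + profile W (p ∷ʳ x) (g ∘ (2 +_)) ≡⟨ distSum-child W p x g ⟩
  distSum W p (g ∘ suc) + profile W (p ∷ʳ x) g           ≡⟨ cong (distSum W p (g ∘ suc) +_) (same-profile g) ⟩
  distSum W p (g ∘ suc) + profile W (p ∷ʳ y) g           ≡⟨ distSum-child W p y g ⟨
  distSum W (p ∷ʳ y) g + profile W (p ∷ʳ y) (g ∘ (2 +_))
    ≡⟨ cong (distSum W (p ∷ʳ y) g +_) (same-profile _) ⟨
  distSum W (p ∷ʳ y) g + profile W (p ∷ʳ x) (g ∘ (2 +_)) ∎)
  where open ≡-Reasoning

resolving⇒sibling-profiles-differ : ∀ {W : List (Vertex k h)} → IsMResolving W → ∀ p {x y} → x ≢ y →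
  length (p ∷ʳ x) ≤ h → length (p ∷ʳ y) ≤ h →
  ¬ (∀ φ → profile W (p ∷ʳ x) φ ≡ profile W (p ∷ʳ y) φ)
resolving⇒sibling-profiles-differ {W = W} W-resolving p {x} {y} x≢y px≤h py≤h same-profile =
  x≢y (∷ʳ-injectiveʳ p p (cong proj₁ (W-resolving px py
    (distSum-≡⇒rm-↭ W px py (siblings-distSum-≡ W p x y same-profile)))))
  where
  px py : Vertex _ _
  px = p ∷ʳ x , px≤h
  py = p ∷ʳ y , py≤h

resolving⇒sibling-leaves-differ : ∀ {W : List (Vertex k h)} → IsMResolving W → ∀ p {x y} → x ≢ y →
  length (p ∷ʳ x) ≡ h → length (p ∷ʳ y) ≡ h → multiplicity W (p ∷ʳ x) ≢ multiplicity W (p ∷ʳ y)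
resolving⇒sibling-leaves-differ {W = W} W-resolving p x≢y px≡h py≡h same-multiplicity =
  resolving⇒sibling-profiles-differ W-resolving p x≢y (≤-reflexive px≡h) (≤-reflexive py≡h) λ φ →
    trans (profile-leaf W _ φ px≡h) (trans (cong (_* φ 0) same-multiplicity) (sym (profile-leaf W _ φ py≡h)))

≥3-children⇒¬resolving : ∀ k h (W : List (Vertex (3 + k) (suc h))) → Unique W → ¬ IsMResolving W
≥3-children⇒¬resolving k h W W-unique W-resolving =
  let i , j , i<j , same = pigeonhole (s≤s (s≤s (s≤s z≤n))) multiplicityOfLeaf in
  resolving⇒sibling-leaves-differ W-resolving p (<⇒≢ᶠ i<j) (leaf-level i) (leaf-level j)
    (fromℕ<-injective _ _ _ _ same)
  where
  p : List (Fin (3 + k))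
  p = replicate h 0F
  leaf-level : ∀ i → length (p ∷ʳ i) ≡ suc h
  leaf-level i = trans (length-∷ʳ p i) (cong suc (length-replicate h))
  multiplicityOfLeaf : Fin (3 + k) → Fin 2
  multiplicityOfLeaf i = fromℕ< (s≤s (multiplicity≤1 W-unique (p ∷ʳ i)))

root : Vertex k h
root = [] , z≤n

unary-paths-≡ : ∀ (u v : List (Fin 1)) → length u ≡ length v → u ≡ v
unary-paths-≡ [] [] _ = refl
unary-paths-≡ (0F ∷ u) (0F ∷ v) u≡v = cong (0F ∷_) (unary-paths-≡ u v (suc-injective u≡v))

root-resolving : IsMResolving {1} {h} [ root ]
root-resolving u v u↭v = vertex-≡ (unary-paths-≡ _ _
  (trans (sym (pathDist-[]ʳ (proj₁ u))) (trans (∷-injectiveˡ (↭-singleton-inv u↭v)) (pathDist-[]ʳ (proj₁ v)))))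

-- The depth profile of a set containing exactly one child of each internal vertex of the
-- binary tree of height m: 2 ^ (d ∸ 1) vertices at each depth d = 1, …, m.
oneChildProfile : ℕ → (ℕ → ℕ) → ℕ
oneChildProfile zero φ = 0
oneChildProfile (suc m) φ = φ 1 + (oneChildProfile m (φ ∘ suc) + oneChildProfile m (φ ∘ suc))

oneChildProfile-deepest : ∀ m φ → φ (suc m) ≤ oneChildProfile (suc m) φ
oneChildProfile-deepest zero φ = m≤m+n (φ 1) 0
oneChildProfile-deepest (suc m) φ =
  ≤-trans (oneChildProfile-deepest m (φ ∘ suc)) (≤-trans (m≤m+n _ _) (m≤n+m _ (φ 1)))

oneChildProfile-size : ∀ m → oneChildProfile m (λ _ → 1) ≡ 2 ^ m ∸ 1
oneChildProfile-size m = trans (sym (m+n∸n≡m _ 1)) (cong (_∸ 1) (size+1 m))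
  where
  double : ∀ n → suc (n + n) + 1 ≡ (n + 1) + ((n + 1) + 0)
  double = solve-∀
  size+1 : ∀ m → oneChildProfile m (λ _ → 1) + 1 ≡ 2 ^ m
  size+1 zero = refl
  size+1 (suc m) = trans (double (oneChildProfile m (λ _ → 1))) (cong (λ n → n + (n + 0)) (size+1 m))

weightBelow-split : ∀ (r w : List (Fin 2)) φ → weightBelow r w φ
  ≡ 𝟙[ r ≟ₚ w ] * φ 0 + (weightBelow (r ∷ʳ 0F) w (φ ∘ suc) + weightBelow (r ∷ʳ 1F) w (φ ∘ suc))
weightBelow-split [] [] φ = sym (trans (+-identityʳ _) (*-identityˡ (φ 0)))
weightBelow-split [] (0F ∷ w) φ = sym (+-identityʳ _)
weightBelow-split [] (1F ∷ w) φ = refl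
weightBelow-split (x ∷ r) [] φ = refl
weightBelow-split (x ∷ r) (y ∷ w) φ = by-heads (x ≟ᶠ y)
  where
  by-heads : Dec (x ≡ y) → weightBelow (x ∷ r) (y ∷ w) φ ≡ 𝟙[ (x ∷ r) ≟ₚ (y ∷ w) ] * φ 0
    + (weightBelow (x ∷ r ∷ʳ 0F) (y ∷ w) (φ ∘ suc) + weightBelow (x ∷ r ∷ʳ 1F) (y ∷ w) (φ ∘ suc))
  by-heads (yes refl)
    rewrite weightBelow-∷ x r w φ | 𝟙-∷ x r w
          | weightBelow-∷ x (r ∷ʳ 0F) w (φ ∘ suc) | weightBelow-∷ x (r ∷ʳ 1F) w (φ ∘ suc)
    = weightBelow-split r w φ
  by-heads (no x≢y)
    rewrite weightBelow-∷-≢ x≢y r w φ | 𝟙-∷-≢ x≢y r w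
          | weightBelow-∷-≢ x≢y (r ∷ʳ 0F) w (φ ∘ suc) | weightBelow-∷-≢ x≢y (r ∷ʳ 1F) w (φ ∘ suc)
    = refl

descendantProfile : List (Vertex 2 h) → List (Fin 2) → (ℕ → ℕ) → ℕ
descendantProfile W r φ = profile W (r ∷ʳ 0F) (φ ∘ suc) + profile W (r ∷ʳ 1F) (φ ∘ suc)

profile-split : ∀ (W : List (Vertex 2 h)) r φ → profile W r φ ≡ multiplicity W r * φ 0 + descendantProfile W r φ
profile-split W r φ = trans (∑-cong W (λ w → weightBelow-split r (proj₁ w) φ))
  (trans (∑-+ W _ _) (cong₂ _+_ (∑-*ʳ W _ (φ 0)) (∑-+ W _ _)))

≤1-≢⇒+≡1 : ∀ {m n} → m ≤ 1 → n ≤ 1 → m ≢ n → m + n ≡ 1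
≤1-≢⇒+≡1 {0} {0} _ _ 0≢0 = contradiction refl 0≢0
≤1-≢⇒+≡1 {0} {1} _ _ _ = refl
≤1-≢⇒+≡1 {1} {0} _ _ _ = refl
≤1-≢⇒+≡1 {1} {1} _ _ 1≢1 = contradiction refl 1≢1
≤1-≢⇒+≡1 {suc (suc _)} (s≤s ()) _ _
≤1-≢⇒+≡1 {n = suc (suc _)} _ (s≤s ()) _

module _ {W : List (Vertex 2 h)} (W-unique : Unique W) (W-resolving : IsMResolving W) where

  -- By induction from the leaves the two children of r have the same descendant profile, so W
  -- must separate them by membership: it contains exactly one of them.
  resolving⇒descendantProfile : ∀ m r → length r + m ≡ h →
    ∀ φ → descendantProfile W r φ ≡ oneChildProfile m φ
  resolving⇒descendantProfile zero r r≡h φ =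
    cong₂ _+_ (profile-beyond W (r ∷ʳ 0F) _ (beyond 0F)) (profile-beyond W (r ∷ʳ 1F) _ (beyond 1F))
    where
    beyond : ∀ x → h < length (r ∷ʳ x)
    beyond x = subst (_< length (r ∷ʳ x)) (trans (sym (+-identityʳ _)) r≡h) (≤-reflexive (sym (length-∷ʳ r x)))
  resolving⇒descendantProfile (suc m) r r+1+m≡h φ = begin
    descendantProfile W r φ
      ≡⟨ cong₂ _+_ (child-profile 0F ψ) (child-profile 1F ψ) ⟩
    (m₀ * φ 1 + V) + (m₁ * φ 1 + V)
      ≡⟨ interchange +-commutativeSemigroup (m₀ * φ 1) V (m₁ * φ 1) V ⟩
    (m₀ * φ 1 + m₁ * φ 1) + (V + V)
      ≡⟨ cong (_+ (V + V)) (*-distribʳ-+ (φ 1) m₀ m₁) ⟨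
    (m₀ + m₁) * φ 1 + (V + V)
      ≡⟨ cong (λ c → c * φ 1 + (V + V)) exactly-one-child ⟩
    1 * φ 1 + (V + V)
      ≡⟨ cong (_+ (V + V)) (*-identityˡ (φ 1)) ⟩
    oneChildProfile (suc m) φ ∎
    where
    open ≡-Reasoning
    ψ : ℕ → ℕ
    ψ = φ ∘ suc
    V m₀ m₁ : ℕ
    V = oneChildProfile m ψ
    m₀ = multiplicity W (r ∷ʳ 0F)
    m₁ = multiplicity W (r ∷ʳ 1F)
    child-level : ∀ x → length (r ∷ʳ x) + m ≡ h
    child-level x = trans (cong (_+ m) (length-∷ʳ r x)) (trans (sym (+-suc (length r) m)) r+1+m≡h)
    child-profile : ∀ x χ → profile W (r ∷ʳ x) χ ≡ multiplicity W (r ∷ʳ x) * χ 0 + oneChildProfile m χ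
    child-profile x χ =
      trans (profile-split W (r ∷ʳ x) χ) (cong (_ +_) (resolving⇒descendantProfile m (r ∷ʳ x) (child-level x) χ))
    child-bound : ∀ x → length (r ∷ʳ x) ≤ h
    child-bound x = ≤-trans (m≤m+n _ m) (≤-reflexive (child-level x))
    exactly-one-child : m₀ + m₁ ≡ 1
    exactly-one-child = ≤1-≢⇒+≡1 (multiplicity≤1 W-unique _) (multiplicity≤1 W-unique _) λ same →
      resolving⇒sibling-profiles-differ W-resolving r (λ ()) (child-bound 0F) (child-bound 1F) λ χ →
        trans (child-profile 0F χ) (trans (cong (λ c → c * χ 0 + _) same) (sym (child-profile 1F χ)))

  resolving⇒size≥ : 2 ^ h ∸ 1 ≤ length W
  resolving⇒size≥ = begin
    2 ^ h ∸ 1                                                  ≡⟨ oneChildProfile-size h ⟨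
    oneChildProfile h (λ _ → 1)                                ≡⟨ resolving⇒descendantProfile h [] refl _ ⟨
    descendantProfile W [] (λ _ → 1)                           ≤⟨ m≤n+m _ (multiplicity W [] * 1) ⟩
    multiplicity W [] * 1 + descendantProfile W [] (λ _ → 1)   ≡⟨ profile-split W [] _ ⟨
    profile W [] (λ _ → 1)                                     ≡⟨ ∑-1≡length W ⟩
    length W ∎
    where open ≤-Reasoning

under : Fin k → Vertex k h → Vertex k (suc h)
under x (p , p≤h) = x ∷ p , s≤s p≤h

under-injective : ∀ {x : Fin k} {v w : Vertex k h} → under x v ≡ under x w → v ≡ w
under-injective v≡w = vertex-≡ (∷-injectiveʳ (cong proj₁ v≡w))

subtrees-disjoint : ∀ {x y : Fin k} → x ≢ y → (vs ws : List (Vertex k h)) →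
  Disjoint (map (under x) vs) (map (under y) ws)
subtrees-disjoint {x = x} {y} x≢y vs ws (v∈xs , v∈ys) with ∈-map⁻ (under x) v∈xs | ∈-map⁻ (under y) v∈ys
... | _ , _ , refl | _ , _ , x≡y = x≢y (∷-injectiveˡ (cong proj₁ x≡y))

distSum-under : ∀ (L : List (Vertex k h)) x u g → distSum (map (under x) L) (x ∷ u) g ≡ distSum L u g
distSum-under L x u g = trans (∑-map (under x) L _) (∑-cong L (λ w → cong g (pathDist-∷ x u (proj₁ w))))

distSum-under-≢ : ∀ (L : List (Vertex k h)) {x y} → x ≢ y → ∀ u g →
  distSum (map (under y) L) (x ∷ u) g ≡ profile L [] (λ l → g (suc (length u) + suc l))
distSum-under-≢ L {y = y} x≢y u g =
  trans (∑-map (under y) L _) (∑-cong L (λ w → cong g (pathDist-∷-≢ x≢y u (proj₁ w))))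

leftChildren : (h : ℕ) → List (Vertex 2 h)
leftChildren zero = []
leftChildren (suc h) = under 0F root ∷ map (under 0F) (leftChildren h) ++ map (under 1F) (leftChildren h)

leftChildren-nonroot : ∀ h → All (root ≢_) (leftChildren h)
leftChildren-nonroot zero = []
leftChildren-nonroot (suc h) = (λ ()) ∷ Allₚ.++⁺ (under-nonroot 0F) (under-nonroot 1F)
  where
  under-nonroot : ∀ x → All (root ≢_) (map (under x) (leftChildren h))
  under-nonroot x = Allₚ.map⁺ (All.universal (λ _ ()) (leftChildren h))

leftChildren-unique : ∀ h → Unique (leftChildren h)
leftChildren-unique zero = []
leftChildren-unique (suc h) =
  Allₚ.++⁺ (Allₚ.map⁺ {f = under 0F} (All.map (_∘ under-injective) (leftChildren-nonroot h)))
           (Allₚ.map⁺ {f = under 1F} (All.universal (λ _ ()) (leftChildren h)))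
  ∷ Uniqueₚ.++⁺ (Uniqueₚ.map⁺ under-injective (leftChildren-unique h))
                (Uniqueₚ.map⁺ under-injective (leftChildren-unique h))
                (subtrees-disjoint (λ ()) _ _)

profile-leftChildren : ∀ h φ → profile (leftChildren h) [] φ ≡ oneChildProfile h φ
profile-leftChildren zero φ = refl
profile-leftChildren (suc h) φ = cong (φ 1 +_) (trans
  (∑-++ (map (under 0F) L) (map (under 1F) L) depth)
  (cong₂ _+_ (trans (∑-map (under 0F) L depth) (profile-leftChildren h (φ ∘ suc)))
             (trans (∑-map (under 1F) L depth) (profile-leftChildren h (φ ∘ suc)))))
  where
  L : List (Vertex 2 h)
  L = leftChildren h
  depth : Vertex 2 (suc h) → ℕ
  depth w = φ (length (proj₁ w))

leftChildren-size : ∀ h → length (leftChildren h) ≡ 2 ^ h ∸ 1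
leftChildren-size h =
  trans (sym (∑-1≡length (leftChildren h))) (trans (profile-leftChildren h _) (oneChildProfile-size h))

dist₀ : Fin 2 → ℕ → ℕ
dist₀ 0F a = a
dist₀ 1F a = 2 + a

pathDist-∷-[0F] : ∀ x (u : List (Fin 2)) → pathDist (x ∷ u) [ 0F ] ≡ dist₀ x (length u)
pathDist-∷-[0F] 0F u = trans (pathDist-∷ 0F u []) (pathDist-[]ʳ u)
pathDist-∷-[0F] 1F u = +-comm (suc (length u)) 1

dist₀≤ : ∀ x a → dist₀ x a ≤ 2 + a
dist₀≤ 0F a = m≤n+m a 2
dist₀≤ 1F a = ≤-refl

distSum-leftChildren-∷ : ∀ h x u g → distSum (leftChildren (suc h)) (x ∷ u) g
  ≡ g (dist₀ x (length u))
    + (distSum (leftChildren h) u g + profile (leftChildren h) [] (λ l → g (suc (length u) + suc l)))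
distSum-leftChildren-∷ h x u g =
  cong₂ _+_ (cong g (pathDist-∷-[0F] x u)) (trans (∑-++ (map (under 0F) L) (map (under 1F) L) _) (subtrees x))
  where
  L : List (Vertex 2 h)
  L = leftChildren h
  subtrees : ∀ x → distSum (map (under 0F) L) (x ∷ u) g + distSum (map (under 1F) L) (x ∷ u) g
    ≡ distSum L u g + profile L [] (λ l → g (suc (length u) + suc l))
  subtrees 0F = cong₂ _+_ (distSum-under L 0F u g) (distSum-under-≢ L (λ ()) u g)
  subtrees 1F = trans (+-comm (distSum (map (under 0F) L) (1F ∷ u) g) _)
    (cong₂ _+_ (distSum-under L 1F u g) (distSum-under-≢ L (λ ()) u g))

atMost : ℕ → ℕ → ℕ
atMost t s = 𝟙[ s ≤? t ]

leftChildren-ball-count : ∀ h t (u v : List (Fin 2)) → length u ≡ length v → length u < t →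
  distSum (leftChildren h) u (atMost t) ≡ distSum (leftChildren h) v (atMost t)
leftChildren-ball-count zero t u v _ _ = refl
leftChildren-ball-count (suc h) t [] [] _ _ = refl
leftChildren-ball-count (suc h) t (x ∷ u) (y ∷ v) xu≡yv xu<t = begin
  distSum (leftChildren (suc h)) (x ∷ u) (atMost t)
    ≡⟨ distSum-leftChildren-∷ h x u (atMost t) ⟩
  atMost t (dist₀ x (length u)) + (distSum L u (atMost t) + far (length u))
    ≡⟨ cong₂ _+_ (trans (near x u xu<t) (sym (near y v (subst (_< t) xu≡yv xu<t))))
                 (cong₂ _+_ (leftChildren-ball-count h t u v u≡v (<-trans (n<1+n _) xu<t)) (cong far u≡v)) ⟩
  atMost t (dist₀ y (length v)) + (distSum L v (atMost t) + far (length v))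
    ≡⟨ distSum-leftChildren-∷ h y v (atMost t) ⟨
  distSum (leftChildren (suc h)) (y ∷ v) (atMost t) ∎
  where
  open ≡-Reasoning
  L : List (Vertex 2 h)
  L = leftChildren h
  u≡v : length u ≡ length v
  u≡v = suc-injective xu≡yv
  far : ℕ → ℕ
  far n = profile L [] (λ l → atMost t (suc n + suc l))
  near : ∀ x (u : List (Fin 2)) → length (x ∷ u) < t → atMost t (dist₀ x (length u)) ≡ 1
  near x u xu<t = 𝟙-yes (_ ≤? t) (≤-trans (dist₀≤ x (length u)) xu<t)

-- Counting distances ≤ length u + 1 sees the vertex [ 0F ] from 0F ∷ u but not from 1F ∷ v,
-- while the counts inside the two subtrees agree by leftChildren-ball-count.
leftChildren-0F≁1F : ∀ h (u v : List (Fin 2)) → length u ≡ length v →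
  ¬ (∀ g → distSum (leftChildren (suc h)) (0F ∷ u) g ≡ distSum (leftChildren (suc h)) (1F ∷ v) g)
leftChildren-0F≁1F h u v u≡v same = 1+n≢n (begin
  1 + rest                                                  ≡⟨ cong (_+ rest) (𝟙-yes (_ ≤? t) (n≤1+n _)) ⟨
  B (length u) + rest                                       ≡⟨ distSum-leftChildren-∷ h 0F u B ⟨
  distSum (leftChildren (suc h)) (0F ∷ u) B                 ≡⟨ same B ⟩
  distSum (leftChildren (suc h)) (1F ∷ v) B                 ≡⟨ distSum-leftChildren-∷ h 1F v B ⟩
  B (2 + length v) + (distSum L v B + far (length v))
    ≡⟨ cong (_+ (distSum L v B + far (length v))) (𝟙-no (_ ≤? t) too-far) ⟩
  distSum L v B + far (length v)
    ≡⟨ cong₂ _+_ (leftChildren-ball-count h t u v u≡v ≤-refl) (cong far u≡v) ⟨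
  rest ∎)
  where
  open ≡-Reasoning
  L : List (Vertex 2 h)
  L = leftChildren h
  t : ℕ
  t = suc (length u)
  B : ℕ → ℕ
  B = atMost t
  far : ℕ → ℕ
  far n = profile L [] (λ l → B (suc n + suc l))
  rest : ℕ
  rest = distSum L u B + far (length u)
  too-far : ¬ (2 + length v ≤ t)
  too-far 2+v≤t = 1+n≰n (subst (λ n → suc n ≤ length u) (sym u≡v) (≤-pred 2+v≤t))

-- For h ≥ 2 the largest distance from u to a left child is length u + h, attained at a leaf in
-- the other subtree of the root; for h = 1 the three vertices are compared directly.
leftChildren-separates-levels : ∀ h (u v : List (Fin 2)) → length u ≤ h → length v ≤ h → length u < length v →
  ¬ (∀ g → distSum (leftChildren h) u g ≡ distSum (leftChildren h) v g)
leftChildren-separates-levels zero u [] _ _ () _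
leftChildren-separates-levels zero u (_ ∷ _) _ () _ _
leftChildren-separates-levels 1 [] [] _ _ () _
leftChildren-separates-levels 1 [] (0F ∷ []) _ _ _ same with () ← same id
leftChildren-separates-levels 1 [] (1F ∷ []) _ _ _ same with () ← same id
leftChildren-separates-levels 1 [] (_ ∷ _ ∷ _) _ (s≤s ()) _ _
leftChildren-separates-levels 1 (_ ∷ _) [] _ _ () _
leftChildren-separates-levels 1 (_ ∷ _) (_ ∷ []) _ _ (s≤s ()) _
leftChildren-separates-levels 1 (_ ∷ _) (_ ∷ _ ∷ _) _ (s≤s ()) _ _
leftChildren-separates-levels (suc (suc n)) u [] _ _ () _
leftChildren-separates-levels (suc (suc n)) u (y ∷ v) u≤h _ u<yv same =
  contradiction (≤-trans v-far (≤-reflexive (trans (sym (same far)) u-near))) λ ()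
  where
  H K : ℕ
  H = suc (suc n)
  K = length (y ∷ v) + H
  far : ℕ → ℕ
  far s = 𝟙[ K ≤? s ]
  u-near : distSum (leftChildren H) u far ≡ 0
  u-near = ∑-zero (All.universal (λ w → 𝟙-no (K ≤? _) (<⇒≱ (≤-<-trans (pathDist≤ u (proj₁ w))
    (+-mono-<-≤ u<yv (proj₂ w))))) (leftChildren H))
  v-far : 1 ≤ distSum (leftChildren H) (y ∷ v) far
  v-far = begin
    1                                                        ≡⟨ 𝟙-yes (K ≤? K) ≤-refl ⟨
    far K                                                    ≤⟨ oneChildProfile-deepest n φ ⟩
    oneChildProfile (suc n) φ                                ≡⟨ profile-leftChildren (suc n) φ ⟨
    profile (leftChildren (suc n)) [] φ                      ≤⟨ m≤n+m _ (distSum (leftChildren (suc n)) v far) ⟩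
    distSum (leftChildren (suc n)) v far + profile (leftChildren (suc n)) [] φ
                                                             ≤⟨ m≤n+m _ (far (dist₀ y (length v))) ⟩
    far (dist₀ y (length v)) + (distSum (leftChildren (suc n)) v far + profile (leftChildren (suc n)) [] φ)
                                                             ≡⟨ distSum-leftChildren-∷ (suc n) y v far ⟨
    distSum (leftChildren H) (y ∷ v) far ∎
    where
    open ≤-Reasoning
    φ : ℕ → ℕ
    φ l = far (suc (length v) + suc l)

leftChildren-tails : ∀ h x (u v : List (Fin 2)) → length u ≡ length v →
  (∀ g → distSum (leftChildren (suc h)) (x ∷ u) g ≡ distSum (leftChildren (suc h)) (x ∷ v) g) →
  ∀ g → distSum (leftChildren h) u g ≡ distSum (leftChildren h) v g
leftChildren-tails h x u v u≡v same g =
  +-cancelʳ-≡ (far (length v)) _ _ (+-cancelˡ-≡ (g (dist₀ x (length v))) _ _ (begin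
  g (dist₀ x (length v)) + (distSum L u g + far (length v))
    ≡⟨ cong (λ n → g (dist₀ x n) + (distSum L u g + far n)) u≡v ⟨
  g (dist₀ x (length u)) + (distSum L u g + far (length u))  ≡⟨ distSum-leftChildren-∷ h x u g ⟨
  distSum (leftChildren (suc h)) (x ∷ u) g                   ≡⟨ same g ⟩
  distSum (leftChildren (suc h)) (x ∷ v) g                   ≡⟨ distSum-leftChildren-∷ h x v g ⟩
  g (dist₀ x (length v)) + (distSum L v g + far (length v)) ∎))
  where
  open ≡-Reasoning
  L : List (Vertex 2 h)
  L = leftChildren h
  far : ℕ → ℕ
  far n = profile L [] (λ l → g (suc n + suc l))

leftChildren-sameLevel : ∀ h (u v : List (Fin 2)) → length u ≡ length v → length u ≤ h →
  (∀ g → distSum (leftChildren h) u g ≡ distSum (leftChildren h) v g) → u ≡ v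
leftChildren-sameLevel h [] [] _ _ _ = refl
leftChildren-sameLevel zero (_ ∷ _) _ _ () _
leftChildren-sameLevel (suc h) (0F ∷ u) (0F ∷ v) xu≡yv (s≤s u≤h) same =
  cong (0F ∷_) (leftChildren-sameLevel h u v u≡v u≤h (leftChildren-tails h 0F u v u≡v same))
  where
  u≡v : length u ≡ length v
  u≡v = suc-injective xu≡yv
leftChildren-sameLevel (suc h) (1F ∷ u) (1F ∷ v) xu≡yv (s≤s u≤h) same =
  cong (1F ∷_) (leftChildren-sameLevel h u v u≡v u≤h (leftChildren-tails h 1F u v u≡v same))
  where
  u≡v : length u ≡ length v
  u≡v = suc-injective xu≡yv
leftChildren-sameLevel (suc h) (0F ∷ u) (1F ∷ v) xu≡yv _ same =
  ⊥-elim (leftChildren-0F≁1F h u v (suc-injective xu≡yv) same)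
leftChildren-sameLevel (suc h) (1F ∷ u) (0F ∷ v) xu≡yv _ same =
  ⊥-elim (leftChildren-0F≁1F h v u (suc-injective (sym xu≡yv)) (sym ∘ same))

leftChildren-separates : ∀ h (u v : List (Fin 2)) → length u ≤ h → length v ≤ h →
  (∀ g → distSum (leftChildren h) u g ≡ distSum (leftChildren h) v g) → u ≡ v
leftChildren-separates h u v u≤h v≤h same with <-cmp (length u) (length v)
... | tri< u<v _ _ = ⊥-elim (leftChildren-separates-levels h u v u≤h v≤h u<v same)
... | tri≈ _ u≡v _ = leftChildren-sameLevel h u v u≡v u≤h same
... | tri> _ _ v<u = ⊥-elim (leftChildren-separates-levels h v u v≤h u≤h v<u (sym ∘ same))

leftChildren-resolving : ∀ h → IsMResolving (leftChildren h)
leftChildren-resolving h u v u↭v =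
  vertex-≡ (leftChildren-separates h _ _ (proj₂ u) (proj₂ v) (rm-↭⇒distSum-≡ _ u v u↭v))

theorem3p7 : ((k h : ℕ) → 1 ≤ k → 1 ≤ h → (MdFinite k h ⇔ (k ≡ 1 ⊎ k ≡ 2)))
    × ((h : ℕ) → 1 ≤ h → MdEq 2 h (2 ^ h ∸ 1))
theorem3p7 = (λ k h 1≤k 1≤h → mk⇔ (finite⇒k≤2 k h 1≤k 1≤h) (k≤2⇒finite k h)) , binary
  where
  finite⇒k≤2 : ∀ k h → 1 ≤ k → 1 ≤ h → MdFinite k h → k ≡ 1 ⊎ k ≡ 2
  finite⇒k≤2 0 _ () _ _
  finite⇒k≤2 1 _ _ _ _ = inj₁ refl
  finite⇒k≤2 2 _ _ _ _ = inj₂ refl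
  finite⇒k≤2 (suc (suc (suc k))) 0 _ () _
  finite⇒k≤2 (suc (suc (suc k))) (suc h) _ _ (W , W-unique , W-resolving) =
    ⊥-elim (≥3-children⇒¬resolving k h W W-unique W-resolving)
  k≤2⇒finite : ∀ k h → k ≡ 1 ⊎ k ≡ 2 → MdFinite k h
  k≤2⇒finite _ h (inj₁ refl) = [ root ] , [] ∷ [] , root-resolving
  k≤2⇒finite _ h (inj₂ refl) = leftChildren h , leftChildren-unique h , leftChildren-resolving h
  binary : ∀ h → 1 ≤ h → MdEq 2 h (2 ^ h ∸ 1)
  binary h _ = (leftChildren h , leftChildren-unique h , leftChildren-resolving h , leftChildren-size h)
             , λ W W-unique W-resolving → resolving⇒size≥ W-unique W-resolving
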